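{- Let $\rho=l\to r$ be a linear term rewrite rule over a signature $\Sigma$ and $G$ a finite $\Sigma^\circ$-labeled graph. For any match morphism $m:l^\circ\rightarrowtail G$ of a PBPO$^+$ rewrite step via $\rho^\circ$ (i.e., there is $\alpha:G\to\mathcal{C}[l^\circ{\downarrow_\mathcal{X}}]$ with $\alpha\circ m=t_L$ such that $l^\circ$ with $1_{l^\circ}$ and $m$ is a pullback of $t_L$ and $\alpha$), the image $m(l^\circ)$ lies in precisely one zone of the zoning of $G$.
   Context: Terms over $\Sigma$ (arities $\#$) and variables $\mathcal{X}$; linear = each variable at most once; rule $l\to r$ with $l\notin\mathcal{X}$, $\mathrm{Var}(r)\subseteq\mathrm{Var}(l)$, linear if $l,r$ linear. Graphs have vertex/edge labels in the flat lattice $\Sigma^\circ=(\Sigma\uplus\mathbb{N}^+)\uplus\{\bot,\top\}$ ($\bot$ least, $\top$ greatest, others incomparable); morphisms are vertex/edge maps commuting with source/target with $\ell(x)\le\ell(\phi(x))$. For linear $t$, $t^\circ$ has a vertex $p$ labeled $f$ for each position $p$ of $t$ holding a function symbol $f$, a vertex $x$ labeled $\bot$ for each variable $x$ of $t$, and for each position $p$ holding a symbol of arity $n$ and $1\le i\le n$ an edge labeled $i$ from the vertex at $p$ to that at $pi$; root at $\epsilon$. $\mathcal{C}[l^\circ{\downarrow_\mathcal{X}}]$ is obtained from $l^\circ$ by relabeling each variable vertex $x$ to $\top$ and adding a fresh $\top$-vertex $x'$ with $\top$-edges $x\to x'$, $x'\to x'$, and adding a fresh $\top$-vertex $\mathcal{C}$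 with $\top$-edges $\mathcal{C}\to$ root and $\mathcal{C}\to\mathcal{C}$; $t_L$ is the inclusion $l^\circ\rightarrowtail\mathcal{C}[l^\circ{\downarrow_\mathcal{X}}]$. A vertex $v$ of $G$ is in-well-formed (I) if it has at most one incoming edge; out-well-formed (O) if its label $l$ lies in $\Sigma$ and $v$ has precisely $\#(l)$ outgoing edges, labeled $1,\ldots,\#(l)$; good if it is O and all its children are I, bad otherwise. The zoning of $G$: initially each vertex forms its own zone (a subgraph); repeatedly, if an edge $e$ is not included in any zone and $s(e)$ is good, the zones of $s(e)$ and $t(e)$ are joined along $e$ (if they coincide, $e$ is added to that zone); stop when no such edge remains. "Lies in a zone" means all vertices and edges of $m(l^\circ)$ belong to that zone. -}

module Defs where

open import Data.Nat using (ℕ; suc)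
open import Data.Fin using (Fin; toℕ)
open import Data.Vec using (Vec; lookup)
open import Data.Maybe using (Maybe; just; nothing)
open import Data.Product using (Σ; ∃; _×_; _,_)
open import Data.Empty using (⊥)
open import Relation.Binary.PropositionalEquality using (_≡_; refl)

record Signature : Set₁ where
  field
    Sym : Set
    ar  : Sym → ℕ
open Signature public

module _ (S : Signature) (X : Set) where

  data Term : Set where
    var : X → Term
    fun : (f : Sym S) → Vec Term (ar S f) → Term

module _ {S : Signature} {X : Set} where

  -- positions of a term (ε = root, p i = arg i p)
  data Pos : Term S X → Set where
    root : ∀ {t : Term S X} → Pos t
    arg  : ∀ {f ts} (i : Fin (ar S f)) → Pos (lookup ts i) → Pos (fun f ts)

  varAt : ∀ {t : Term S X} → Pos t → Maybe X
  varAt {var x}   root      = just x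
  varAt {fun f _} root      = nothing
  varAt           (arg i p) = varAt p

  Linear : Term S X → Set
  Linear t = ∀ (p q : Pos t) (x : X) → varAt p ≡ just x → varAt q ≡ just x → p ≡ q

  IsVariable : Term S X → Set
  IsVariable t = Σ X λ x → t ≡ var x

  _VarsIn_ : Term S X → Term S X → Set
  r VarsIn l = ∀ (p : Pos r) (x : X) → varAt p ≡ just x → Σ (Pos l) λ q → varAt q ≡ just x

module _ (S : Signature) (X : Set) where

  record Rule : Set where
    field
      lhs : Term S X
      rhs : Term S X
      lhs-not-var : IsVariable lhs → ⊥
      vars⊆       : rhs VarsIn lhs

  LinearRule : Rule → Set
  LinearRule ρ = Linear (Rule.lhs ρ) × Linear (Rule.rhs ρ)

module _ (S : Signature) where

  data Label : Set where
    sym : Sym S → Label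
    pos : ℕ → Label      -- pos k  is the positive natural number  suc k
    bot : Label
    top : Label

module _ {S : Signature} where

  data _⊑_ : Label S → Label S → Set where
    bot⊑  : ∀ {x} → bot ⊑ x
    ⊑top  : ∀ {x} → x ⊑ top
    ⊑refl : ∀ {x} → x ⊑ x

  ⊑-trans : ∀ {x y z} → x ⊑ y → y ⊑ z → x ⊑ z
  ⊑-trans bot⊑  _     = bot⊑
  ⊑-trans _     ⊑top  = ⊑top
  ⊑-trans ⊑refl q     = q
  ⊑-trans ⊑top  ⊑refl = ⊑top

module _ (S : Signature) where

  record Graph : Set₁ where
    field
      V   : Set
      E   : Set
      src : E → V
      tgt : E → V
      lv  : V → Label S
      le  : E → Label S
  open Graph public

  record FinGraph : Set where
    field
      nV  : ℕ
      nE  : ℕ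
      src : Fin nE → Fin nV
      tgt : Fin nE → Fin nV
      lv  : Fin nV → Label S
      le  : Fin nE → Label S

  finGraph : FinGraph → Graph
  finGraph G = record
    { V = Fin (FinGraph.nV G) ; E = Fin (FinGraph.nE G)
    ; src = FinGraph.src G ; tgt = FinGraph.tgt G
    ; lv = FinGraph.lv G ; le = FinGraph.le G }

module _ {S : Signature} where

  record _⇒_ (G H : Graph S) : Set where
    field
      fV : V G → V H
      fE : E G → E H
      src-comm : ∀ e → fV (src G e) ≡ src H (fE e)
      tgt-comm : ∀ e → fV (tgt G e) ≡ tgt H (fE e)
      lv-mono  : ∀ v → lv G v ⊑ lv H (fV v)
      le-mono  : ∀ e → le G e ⊑ le H (fE e)
  open _⇒_ public

  idM : ∀ {G} → G ⇒ G
  idM = record { fV = λ v → v ; fE = λ e → e ; src-comm = λ _ → refl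
               ; tgt-comm = λ _ → refl ; lv-mono = λ _ → ⊑refl ; le-mono = λ _ → ⊑refl }

  _∘M_ : ∀ {G H K} → H ⇒ K → G ⇒ H → G ⇒ K
  _∘M_ {G} {H} {K} g f = record
    { fV = λ v → fV g (fV f v)
    ; fE = λ e → fE g (fE f e)
    ; src-comm = λ e → trans' (cong' (fV g) (src-comm f e)) (src-comm g (fE f e))
    ; tgt-comm = λ e → trans' (cong' (fV g) (tgt-comm f e)) (tgt-comm g (fE f e))
    ; lv-mono = λ v → ⊑-trans (lv-mono f v) (lv-mono g (fV f v))
    ; le-mono = λ e → ⊑-trans (le-mono f e) (le-mono g (fE f e)) }
    where
      cong' : ∀ {A B : Set} (h : A → B) {a b} → a ≡ b → h a ≡ h b
      cong' h refl = refl
      trans' : ∀ {A : Set} {a b c : A} → a ≡ b → b ≡ c → a ≡ c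
      trans' refl q = q

  _≈M_ : ∀ {G H} → G ⇒ H → G ⇒ H → Set
  f ≈M g = (∀ v → fV f v ≡ fV g v) × (∀ e → fE f e ≡ fE g e)

  Mono : ∀ {G H} → G ⇒ H → Set₁
  Mono {G} {H} m = ∀ (K : Graph S) (a b : K ⇒ G) → (m ∘M a) ≈M (m ∘M b) → a ≈M b

  IsPullback : ∀ {A B C P} (f : A ⇒ C) (g : B ⇒ C) (p₁ : P ⇒ A) (p₂ : P ⇒ B) → Set₁
  IsPullback {A} {B} {C} {P} f g p₁ p₂ =
    ((f ∘M p₁) ≈M (g ∘M p₂)) ×
    (∀ (H : Graph S) (h₁ : H ⇒ A) (h₂ : H ⇒ B) → (f ∘M h₁) ≈M (g ∘M h₂) →
       Σ (H ⇒ P) λ u → ((p₁ ∘M u) ≈M h₁) × ((p₂ ∘M u) ≈M h₂) ×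
         (∀ (u' : H ⇒ P) → (p₁ ∘M u') ≈M h₁ → (p₂ ∘M u') ≈M h₂ → u' ≈M u))

module _ {S : Signature} {X : Set} where

  -- edges of t°: one edge from p to p i for each position p of a symbol
  -- of arity n and each 1 ≤ i ≤ n
  data EPos : Term S X → Set where
    child  : ∀ {f ts} (i : Fin (ar S f)) → EPos (fun f ts)
    deeper : ∀ {f ts} (i : Fin (ar S f)) → EPos (lookup ts i) → EPos (fun f ts)

  esrc : ∀ {t : Term S X} → EPos t → Pos t
  esrc (child i)    = root
  esrc (deeper i e) = arg i (esrc e)

  etgt : ∀ {t : Term S X} → EPos t → Pos t
  etgt (child i)    = arg i root
  etgt (deeper i e) = arg i (etgt e)

  elab : ∀ {t : Term S X} → EPos t → Label S
  elab (child i)    = pos (toℕ i)      -- the number  i+1  (Fin is 0-based)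
  elab (deeper i e) = elab e

  vlab : ∀ {t : Term S X} → Pos t → Label S
  vlab {var x}   root      = bot
  vlab {fun f _} root      = sym f
  vlab           (arg i p) = vlab p

  vlabC : ∀ {t : Term S X} → Pos t → Label S
  vlabC {var x}   root      = top
  vlabC {fun f _} root      = sym f
  vlabC           (arg i p) = vlabC p

  vlab⊑vlabC : ∀ {t : Term S X} (p : Pos t) → vlab p ⊑ vlabC p
  vlab⊑vlabC {var x}   root      = bot⊑
  vlab⊑vlabC {fun f _} root      = ⊑refl
  vlab⊑vlabC           (arg i p) = vlab⊑vlabC p

  -- variable positions (for linear t: the variables of t)
  data VPos : Term S X → Set where
    here  : ∀ {x} → VPos (var x)
    varg  : ∀ {f ts} (i : Fin (ar S f)) → VPos (lookup ts i) → VPos (fun f ts)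

  vpos : ∀ {t : Term S X} → VPos t → Pos t
  vpos here       = root
  vpos (varg i v) = arg i (vpos v)

  -- t°  (for linear t the vertex of variable x is its unique position)
  _° : Term S X → Graph S
  t ° = record { V = Pos t ; E = EPos t ; src = esrc ; tgt = etgt ; lv = vlab ; le = elab }

  data CV (t : Term S X) : Set where
    old   : Pos t → CV t
    prime : VPos t → CV t
    ctx   : CV t

  data CE (t : Term S X) : Set where
    oldE      : EPos t → CE t
    toPrime   : VPos t → CE t
    loopPrime : VPos t → CE t
    toRoot    : CE t
    loopCtx   : CE t

  module _ {t : Term S X} where
    csrc : CE t → CV t
    csrc (oldE e)      = old (esrc e)
    csrc (toPrime v)   = old (vpos v)
    csrc (loopPrime v) = prime v
    csrc toRoot        = ctx
    csrc loopCtx       = ctx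

    ctgt : CE t → CV t
    ctgt (oldE e)      = old (etgt e)
    ctgt (toPrime v)   = prime v
    ctgt (loopPrime v) = prime v
    ctgt toRoot        = old root
    ctgt loopCtx       = ctx

    clv : CV t → Label S
    clv (old p)   = vlabC p
    clv (prime v) = top
    clv ctx       = top

    cle : CE t → Label S
    cle (oldE e) = elab e
    cle _        = top

  Ctx : Term S X → Graph S
  Ctx t = record { V = CV t ; E = CE t ; src = csrc ; tgt = ctgt ; lv = clv ; le = cle }

  tL : (t : Term S X) → (t °) ⇒ Ctx t
  tL t = record { fV = old ; fE = oldE ; src-comm = λ _ → refl ; tgt-comm = λ _ → refl
                ; lv-mono = vlab⊑vlabC ; le-mono = λ _ → ⊑refl }

module _ {S : Signature} (G : Graph S) where

  InWF : V G → Set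
  InWF v = ∀ (e e' : E G) → tgt G e ≡ v → tgt G e' ≡ v → e ≡ e'

  OutWF : V G → Set
  OutWF v = Σ (Sym S) λ f → lv G v ≡ sym f ×
    (∀ (e : E G) → src G e ≡ v → Σ (Fin (ar S f)) λ i → le G e ≡ pos (toℕ i)) ×
    (∀ (i : Fin (ar S f)) → Σ (E G) λ e → (src G e ≡ v × le G e ≡ pos (toℕ i)) ×
        (∀ (e' : E G) → src G e' ≡ v → le G e' ≡ pos (toℕ i) → e' ≡ e))

  Good : V G → Set
  Good v = OutWF v × (∀ (e : E G) → src G e ≡ v → InWF (tgt G e))

  -- The zoning procedure joins the zones of s(e) and t(e) along every edge e
  -- whose source is good (and only those).  Two vertices end up in the same
  -- zone iff they are related by the equivalence closure of these joins:
  data SameZone : V G → V G → Set where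
    zrefl  : ∀ {v} → SameZone v v
    zsym   : ∀ {v w} → SameZone v w → SameZone w v
    ztrans : ∀ {u v w} → SameZone u v → SameZone v w → SameZone u w
    zjoin  : ∀ (e : E G) → Good (src G e) → SameZone (src G e) (tgt G e)

  -- an edge is included in a zone iff its source is good; it then belongs
  -- to the zone of its source (= that of its target)
  EdgeInZoneOf : V G → E G → Set
  EdgeInZoneOf v e = Good (src G e) × SameZone v (src G e)

  LiesInZoneOf : ∀ {H : Graph S} → H ⇒ G → V G → Set
  LiesInZoneOf {H} m v = (∀ (x : V H) → SameZone v (fV m x)) × (∀ (e : E H) → EdgeInZoneOf v (fE m e))

  LiesInUniqueZone : ∀ {H : Graph S} → H ⇒ G → Set
  LiesInUniqueZone m = Σ (V G) λ v → LiesInZoneOf m v ×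
    (∀ (w : V G) → LiesInZoneOf m w → SameZone v w)

-- The square with α ∘ m = t_L being a pullback (with 1 on l°) means that every
-- edge of G which α sends into l° ⊆ 𝒞[l°↓X] is the m-image of that edge, and α
-- squeezes the labels of m(l°) to exactly those of l°.  Hence at the image of a
-- function position p the outgoing edges of G are precisely the images of the
-- argument edges of p, and every child has as its only incoming edge the image
-- of its tree edge.  So the image of every edge source is good, every edge of
-- m(l°) is joined into a zone, and since l° is a tree rooted at ε, all of m(l°)
-- lies in the zone of m(ε).
module Submission where

open import Defs
open import Data.Bool using (Bool; true; false)
open import Data.Unit using (⊤; tt)
open import Data.Empty using (⊥-elim)
open import Data.Fin using (Fin; toℕ)
open import Data.Fin.Properties using (toℕ-injective)
open import Data.Vec using (lookup)
open import Data.Product using (Σ; _×_; _,_; proj₁; proj₂)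
open import Relation.Nullary using (¬_)
import Relation.Binary.PropositionalEquality as ≡
open ≡ using (_≡_; refl; cong; trans; subst; subst₂)

module _ {S : Signature} where

  ⊑-antisym : ∀ {x y : Label S} → x ⊑ y → y ⊑ x → x ≡ y
  ⊑-antisym ⊑refl _     = refl
  ⊑-antisym bot⊑  bot⊑  = refl
  ⊑-antisym bot⊑  ⊑refl = refl
  ⊑-antisym ⊑top  ⊑top  = refl
  ⊑-antisym ⊑top  ⊑refl = refl

  pos-injective : ∀ {a b} → pos {S} a ≡ pos b → a ≡ b
  pos-injective refl = refl

  edgeGraph : Graph S
  edgeGraph = record { V = Bool ; E = ⊤ ; src = λ _ → false ; tgt = λ _ → true
                     ; lv = λ _ → bot ; le = λ _ → bot }

  edgeAt : (G : Graph S) → E G → edgeGraph ⇒ G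
  edgeAt G e = record
    { fV = λ { false → src G e ; true → tgt G e } ; fE = λ _ → e
    ; src-comm = λ _ → refl ; tgt-comm = λ _ → refl
    ; lv-mono = λ _ → bot⊑ ; le-mono = λ _ → bot⊑ }

  pullback-idM-edge : ∀ {A B C : Graph S} {f : A ⇒ C} {g : B ⇒ C} {m : A ⇒ B} →
    IsPullback f g idM m → ∀ a b → fE f a ≡ fE g b → fE m a ≡ b
  pullback-idM-edge {A} {B} {C} {f} {g} {m} (_ , universal) a b fa≡gb
    with universal edgeGraph (edgeAt A a) (edgeAt B b) commutes
    where
      commutes : (f ∘M edgeAt A a) ≈M (g ∘M edgeAt B b)
      commutes = (λ { false → trans (src-comm f a) (trans (cong (src C) fa≡gb) (≡.sym (src-comm g b)))
                    ; true  → trans (tgt-comm f a) (trans (cong (tgt C) fa≡gb) (≡.sym (tgt-comm g b))) })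
               , (λ _ → fa≡gb)
  ... | u , (_ , u≡a) , (_ , mu≡b) , _ = trans (cong (fE m) (≡.sym (u≡a tt))) (mu≡b tt)

module TermGraph {S : Signature} {X : Set} where

  vlab≡sym⇒vlabC≡sym : ∀ {t : Term S X} (p : Pos t) {f} → vlab p ≡ sym f → vlabC p ≡ sym f
  vlab≡sym⇒vlabC≡sym {fun g _} root      eq = eq
  vlab≡sym⇒vlabC≡sym           (arg i p) eq = vlab≡sym⇒vlabC≡sym p eq

  vlab-vpos : ∀ {t : Term S X} (v : VPos t) → vlab (vpos v) ≡ bot
  vlab-vpos here       = refl
  vlab-vpos (varg i v) = vlab-vpos v

  vlab-esrc : ∀ {t : Term S X} (e : EPos t) → Σ (Sym S) λ f → vlab (esrc e) ≡ sym f
  vlab-esrc (child {f} i) = f , refl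
  vlab-esrc (deeper i e)  = vlab-esrc e

  elab-bounded : ∀ {t : Term S X} (e : EPos t) {f} → vlab (esrc e) ≡ sym f →
    Σ (Fin (ar S f)) λ i → elab e ≡ pos (toℕ i)
  elab-bounded (child i)    refl = i , refl
  elab-bounded (deeper i e) eq   = elab-bounded e eq

  edge-labelled : ∀ {t : Term S X} (p : Pos t) {f} → vlab p ≡ sym f → (i : Fin (ar S f)) →
    Σ (EPos t) λ e → esrc e ≡ p × elab e ≡ pos (toℕ i)
  edge-labelled {fun g ts} root      refl i = child i , refl , refl
  edge-labelled {fun g ts} (arg j p) eq   i with edge-labelled p eq i
  ... | e , src≡p , lab = deeper j e , cong (arg j) src≡p , lab

  arg-index : ∀ {f ts} {i j : Fin (ar S f)} {p : Pos (lookup ts i)} {q : Pos (lookup ts j)} →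
    arg {S = S} {X} {f} {ts} i p ≡ arg j q → i ≡ j
  arg-index refl = refl

  arg-injective : ∀ {f ts} {i : Fin (ar S f)} {p q : Pos (lookup ts i)} →
    arg {S = S} {X} {f} {ts} i p ≡ arg i q → p ≡ q
  arg-injective refl = refl

  esrc-elab-injective : ∀ {t : Term S X} (e e' : EPos t) →
    esrc e ≡ esrc e' → elab e ≡ elab e' → e ≡ e'
  esrc-elab-injective (child i) (child j) _ lab with toℕ-injective (pos-injective lab)
  ... | refl = refl
  esrc-elab-injective (deeper i e) (deeper j e') eq lab with arg-index {i = i} {j = j} eq
  ... | refl = cong (deeper i) (esrc-elab-injective e e' (arg-injective eq) lab)

  etgt≢root : ∀ {t : Term S X} (e : EPos t) → ¬ etgt e ≡ root
  etgt≢root (child i)    ()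
  etgt≢root (deeper i e) ()

  etgt-injective : ∀ {t : Term S X} (e e' : EPos t) → etgt e ≡ etgt e' → e ≡ e'
  etgt-injective (child i) (child j) refl = refl
  etgt-injective (child i) (deeper j e') eq with arg-index {i = i} {j = j} eq
  ... | refl = ⊥-elim (etgt≢root e' (≡.sym (arg-injective eq)))
  etgt-injective (deeper i e) (child j) eq with arg-index {i = i} {j = j} eq
  ... | refl = ⊥-elim (etgt≢root e (arg-injective eq))
  etgt-injective (deeper i e) (deeper j e') eq with arg-index {i = i} {j = j} eq
  ... | refl = cong (deeper i) (etgt-injective e e' (arg-injective eq))

  Pos-induction : ∀ {t : Term S X} (P : Pos t → Set) → P root →
    (∀ e → P (esrc e) → P (etgt e)) → ∀ p → P p
  Pos-induction P base step root = base
  Pos-induction {fun f ts} P base step (arg i p) =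
    Pos-induction (λ q → P (arg i q)) (step (child i) base) (λ e → step (deeper i e)) p

open TermGraph

old-injective : ∀ {S X} {t : Term S X} {p q : Pos t} → old {t = t} p ≡ old q → p ≡ q
old-injective refl = refl

module PullbackMatch {S : Signature} {X : Set} {l : Term S X} {G : Graph S} (m : (l °) ⇒ G)
  (α : G ⇒ Ctx l) (α∘m≈tL : (α ∘M m) ≈M tL l) (pb : IsPullback (tL l) α idM m) where

  α∘m-old : ∀ p → fV α (fV m p) ≡ old p
  α∘m-old = proj₁ α∘m≈tL

  image-of-old-edge : ∀ e d → oldE e ≡ fE α d → fE m e ≡ d
  image-of-old-edge = pullback-idM-edge {f = tL l} {g = α} {m = m} pb

  lv-m-sym : ∀ p {f} → vlab p ≡ sym f → lv G (fV m p) ≡ sym f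
  lv-m-sym p {f} vlab≡f = ≡.sym (⊑-antisym below above)
    where
      below : sym f ⊑ lv G (fV m p)
      below = subst (_⊑ lv G (fV m p)) vlab≡f (lv-mono m p)
      above : lv G (fV m p) ⊑ sym f
      above = subst (lv G (fV m p) ⊑_)
        (trans (cong clv (α∘m-old p)) (vlab≡sym⇒vlabC≡sym p vlab≡f)) (lv-mono α (fV m p))

  le-m : ∀ e → le G (fE m e) ≡ elab e
  le-m e = ⊑-antisym (subst (le G (fE m e) ⊑_) (cong cle (proj₂ α∘m≈tL e)) (le-mono α (fE m e)))
                     (le-mono m e)

  -- α(d) is an edge of 𝒞[l°↓X] leaving old p; for a function position p the
  -- only such edges are those of l°, as the edges x → x' leave ⊥-labelled vertices.
  out-edge-in-image : ∀ p {f} → vlab p ≡ sym f → ∀ d → src G d ≡ fV m p →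
    Σ (EPos l) λ e → esrc e ≡ p × fE m e ≡ d
  out-edge-in-image p {f} vlab≡f d src≡mp = from (fE α d) refl src-αd
    where
      src-αd : csrc (fE α d) ≡ old p
      src-αd = trans (≡.sym (src-comm α d)) (trans (cong (fV α) src≡mp) (α∘m-old p))
      from : (c : CE l) → fE α d ≡ c → csrc c ≡ old p → Σ (EPos l) λ e → esrc e ≡ p × fE m e ≡ d
      from (oldE e)    αd≡e src≡p = e , old-injective src≡p , image-of-old-edge e d (≡.sym αd≡e)
      from (toPrime v) _    src≡p
        with trans (≡.sym (vlab-vpos v)) (trans (cong vlab (old-injective src≡p)) vlab≡f)
      ... | ()

  in-edge-in-image : ∀ e d → tgt G d ≡ fV m (etgt e) → Σ (EPos l) λ e' → etgt e' ≡ etgt e × fE m e' ≡ d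
  in-edge-in-image e d tgt≡me = from (fE α d) refl tgt-αd
    where
      tgt-αd : ctgt (fE α d) ≡ old (etgt e)
      tgt-αd = trans (≡.sym (tgt-comm α d)) (trans (cong (fV α) tgt≡me) (α∘m-old (etgt e)))
      from : (c : CE l) → fE α d ≡ c → ctgt c ≡ old (etgt e) →
        Σ (EPos l) λ e' → etgt e' ≡ etgt e × fE m e' ≡ d
      from (oldE e') αd≡e' tgt≡ = e' , old-injective tgt≡ , image-of-old-edge e' d (≡.sym αd≡e')
      from toRoot    _     tgt≡ = ⊥-elim (etgt≢root e (≡.sym (old-injective tgt≡)))

  outWF-image : ∀ p {f} → vlab p ≡ sym f → OutWF G (fV m p)
  outWF-image p {f} vlab≡f = f , lv-m-sym p vlab≡f , labelled , unique-labelled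
    where
      labelled : ∀ d → src G d ≡ fV m p → Σ (Fin (ar S f)) λ i → le G d ≡ pos (toℕ i)
      labelled d src≡mp with out-edge-in-image p vlab≡f d src≡mp
      ... | e , refl , refl with elab-bounded e vlab≡f
      ... | i , lab = i , trans (le-m e) lab
      unique-labelled : ∀ i → Σ (E G) λ d → (src G d ≡ fV m p × le G d ≡ pos (toℕ i)) ×
        (∀ d' → src G d' ≡ fV m p → le G d' ≡ pos (toℕ i) → d' ≡ d)
      unique-labelled i with edge-labelled p vlab≡f i
      ... | e , refl , lab = fE m e , (≡.sym (src-comm m e) , trans (le-m e) lab) , unique
        where
          unique : ∀ d' → src G d' ≡ fV m (esrc e) → le G d' ≡ pos (toℕ i) → d' ≡ fE m e
          unique d' src≡ lab' with out-edge-in-image (esrc e) vlab≡f d' src≡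
          ... | e' , src-e'≡ , refl =
            cong (fE m) (esrc-elab-injective e' e src-e'≡ (trans (≡.sym (le-m e')) (trans lab' (≡.sym lab))))

  children-inWF-image : ∀ p {f} → vlab p ≡ sym f → ∀ d → src G d ≡ fV m p → InWF G (tgt G d)
  children-inWF-image p vlab≡f d src≡mp d₁ d₂ tgt₁ tgt₂
    with out-edge-in-image p vlab≡f d src≡mp
  ... | e , _ , refl
    with in-edge-in-image e d₁ (trans tgt₁ (≡.sym (tgt-comm m e)))
       | in-edge-in-image e d₂ (trans tgt₂ (≡.sym (tgt-comm m e)))
  ... | e₁ , tgt-e₁ , refl | e₂ , tgt-e₂ , refl =
    cong (fE m) (etgt-injective e₁ e₂ (trans tgt-e₁ (≡.sym tgt-e₂)))

  good-esrc : ∀ e → Good G (src G (fE m e))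
  good-esrc e = subst (Good G) (src-comm m e)
    (outWF-image (esrc e) vlab≡f , children-inWF-image (esrc e) vlab≡f)
    where vlab≡f = proj₂ (vlab-esrc e)

  sameZone-root : ∀ p → SameZone G (fV m root) (fV m p)
  sameZone-root = Pos-induction (λ p → SameZone G (fV m root) (fV m p)) zrefl
    λ e z → ztrans z (subst₂ (SameZone G) (≡.sym (src-comm m e)) (≡.sym (tgt-comm m e))
                              (zjoin (fE m e) (good-esrc e)))

  liesInUniqueZone : LiesInUniqueZone G m
  liesInUniqueZone = fV m root , (sameZone-root , inZone) , λ w (z , _) → zsym (z root)
    where
      inZone : ∀ e → EdgeInZoneOf G (fV m root) (fE m e)
      inZone e = good-esrc e , subst (SameZone G (fV m root)) (src-comm m e) (sameZone-root (esrc e))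

lemma60 : ∀ (S : Signature) (X : Set) (ρ : Rule S X) → LinearRule S X ρ →
    ∀ (G : FinGraph S) (m : (Rule.lhs ρ °) ⇒ finGraph S G) → Mono m →
    (Σ (finGraph S G ⇒ Ctx (Rule.lhs ρ)) λ α →
       ((α ∘M m) ≈M tL (Rule.lhs ρ)) × IsPullback (tL (Rule.lhs ρ)) α idM m) →
    LiesInUniqueZone (finGraph S G) m
lemma60 S X ρ _ G m _ (α , α∘m≈tL , pb) = PullbackMatch.liesInUniqueZone m α α∘m≈tL pb
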